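{- Let $s$ be a positive integer and $n_1,\dots,n_s,k$ nonnegative integers with $N:=n_1+\cdots+n_s>sk$. If $k>0$, then $$\sum_{l=0}^{N-sk}\binom{N-sk}{l}(-1)^l\xi_{l+sk,q}=q^2\sum_{l=0}^{sk}\binom{sk}{l}(-1)^{sk-l}\xi_{N-l,1/q}.$$ Moreover (case $k=0$, i.e. $N>0$), $$\sum_{l=0}^{N}\binom{N}{l}(-1)^l\xi_{l,q}=[2]_q+q^2\xi_{N,1/q}.$$
   Context: Let $p$ be an odd prime, $\mathbb{C}_p$ the completion of an algebraic closure of $\mathbb{Q}_p$, and $q\in\mathbb{C}_p$ with $|1-q|_p<1$ (then also $|1-q^{ -1}|_p<1$). Put $[2]_q=1+q$. For $Q\in\{q,q^{ -1}\}$ the $Q$-Euler numbers $\xi_{n,Q}$ are defined by $\xi_{0,Q}=1$ and, for $n\ge 1$, $Q\sum_{l=0}^{n}\binom{n}{l}Q^l\xi_{l,Q}+\xi_{n,Q}=0$; $\xi_{n,1/q}$ denotes these numbers for $Q=q^{ -1}$. -}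

module Defs where

open import Level using (Level)
open import Algebra.Bundles using (CommutativeRing)
open import Data.Nat as ℕ using (ℕ; zero; suc)
open import Data.Nat.Combinatorics using (_C_)

module RingDefs {c ℓ : Level} (R : CommutativeRing c ℓ) where
  open CommutativeRing R public

  nat : ℕ → Carrier
  nat zero    = 0#
  nat (suc n) = 1# + nat n

  pow : Carrier → ℕ → Carrier
  pow x zero    = 1#
  pow x (suc n) = x * pow x n

  sgn : ℕ → Carrier
  sgn l = pow (- 1#) l

  sumTo : ℕ → (ℕ → Carrier) → Carrier
  sumTo zero    f = f 0
  sumTo (suc n) f = sumTo n f + f (suc n)

  bin : ℕ → ℕ → Carrier
  bin n l = nat (n C l)

  record IsQEuler (Q : Carrier) (ξ : ℕ → Carrier) : Set ℓ where
    field
      init : ξ 0 ≈ 1#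
      rec  : (n : ℕ) → 1 ℕ.≤ n →
             Q * sumTo n (λ l → bin n l * (pow Q l * ξ l)) + ξ n ≈ 0#

-- Write h n = Σ_l C(n,l) (-1)^l ξ_l and let E be the shift of sequences. Rewriting the q-Euler
-- recurrence with the operators (x + E)^n, which compose by adding the x's, yields
-- q^(n+1) h n + Σ_l C(n,l) q^(n-l) h l = (1 + q)^(n+1). This says exactly that the sequence
-- 1, q^(-2) (h n - (1 + q)) (n ≥ 1) satisfies the q⁻¹-Euler recurrence, whose solution is unique
-- because every 1 + q^(-m) is invertible; hence h n = (1 + q) + q² ξ_(n,1/q) for n ≥ 1.
-- For k > 0, expanding E^m = (1 - (1 - E))^m writes Σ_l C(r,l) (-1)^l ξ_(l+m) = (E^m (1 - E)^r ξ)(0)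
-- through the values h (m + r - l), l ≤ m; in the resulting formula the constant 1 + q is
-- multiplied by Σ_l C(m,l) (-1)^(m-l) = 0.
module Submission where

open import Defs
open import Level using (_⊔_)
open import Algebra.Bundles using (CommutativeRing)
open import Data.Nat as ℕ using (ℕ; _≤_; _<_; zero; suc; z≤n; s≤s; _∸_)
open import Data.Nat.Combinatorics using (_C_; nCn≡1; nCk+nC[k+1]≡[n+1]C[k+1]; k>n⇒nCk≡0)
import Data.Nat.Properties as ℕₚ
open import Data.Vec using (Vec; sum)
open import Data.Product using (Σ; _×_; _,_; proj₂)
open import Data.Sum using (inj₁; inj₂)
open import Relation.Binary.PropositionalEquality as ≡ using (_≡_)

module BinomialSums {c ℓ} (R : CommutativeRing c ℓ) where
  open RingDefs R
  open import Relation.Binary.Reasoning.Setoid setoid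
  open import Algebra.Properties.Ring ring using (-1*x≈-x; +-cancelˡ; //-rightDividesˡ)
  open import Algebra.Solver.Ring.NaturalCoefficients.Default commutativeSemiring
    using (solve; _:+_; _:*_; _:=_)

  nat-+ : ∀ m n → nat (m ℕ.+ n) ≈ nat m + nat n
  nat-+ zero    n = sym (+-identityˡ _)
  nat-+ (suc m) n = trans (+-congˡ (nat-+ m n)) (sym (+-assoc _ _ _))

  bin-0 : ∀ n → bin n 0 ≈ 1#
  bin-0 n = +-identityʳ 1#

  bin-diag : ∀ n → bin n n ≈ 1#
  bin-diag n = trans (reflexive (≡.cong nat (nCn≡1 n))) (+-identityʳ 1#)

  bin-suc : ∀ n k → bin (suc n) (suc k) ≈ bin n k + bin n (suc k)
  bin-suc n k = trans (reflexive (≡.cong nat (≡.sym (nCk+nC[k+1]≡[n+1]C[k+1] n k))))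
                      (nat-+ (n C k) (n C suc k))

  bin-> : ∀ {n k} → n < k → bin n k ≈ 0#
  bin-> n<k = reflexive (≡.cong nat (k>n⇒nCk≡0 n<k))

  pow-cong : ∀ {x y} n → x ≈ y → pow x n ≈ pow y n
  pow-cong zero    x≈y = refl
  pow-cong (suc n) x≈y = *-cong x≈y (pow-cong n x≈y)

  pow-+ : ∀ x m n → pow x (m ℕ.+ n) ≈ pow x m * pow x n
  pow-+ x zero    n = sym (*-identityˡ _)
  pow-+ x (suc m) n = trans (*-congˡ (pow-+ x m n)) (sym (*-assoc _ _ _))

  pow-∸ : ∀ x {j n} → j ≤ n → pow x (n ∸ j) * pow x j ≈ pow x n
  pow-∸ x {j} {n} j≤n = trans (sym (pow-+ x (n ∸ j) j)) (reflexive (≡.cong (pow x) (ℕₚ.m∸n+n≡m j≤n)))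

  pow-* : ∀ x y n → pow (x * y) n ≈ pow x n * pow y n
  pow-* x y zero    = sym (*-identityˡ _)
  pow-* x y (suc n) = trans (*-congˡ (pow-* x y n))
    (solve 4 (λ x y a b → x :* y :* (a :* b) := x :* a :* (y :* b)) refl x y (pow x n) (pow y n))

  pow-1# : ∀ n → pow 1# n ≈ 1#
  pow-1# zero    = refl
  pow-1# (suc n) = trans (*-identityˡ _) (pow-1# n)

  pow-inverse : ∀ {x y} → x * y ≈ 1# → ∀ n → pow x n * pow y n ≈ 1#
  pow-inverse {x} {y} xy≈1 n = trans (sym (pow-* x y n)) (trans (pow-cong n xy≈1) (pow-1# n))

  sumTo-cong : ∀ n {f g : ℕ → Carrier} → (∀ l → f l ≈ g l) → sumTo n f ≈ sumTo n g
  sumTo-cong zero    f≈g = f≈g 0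
  sumTo-cong (suc n) f≈g = +-cong (sumTo-cong n f≈g) (f≈g (suc n))

  sumTo-cong-≤ : ∀ n {f g : ℕ → Carrier} → (∀ l → l ≤ n → f l ≈ g l) → sumTo n f ≈ sumTo n g
  sumTo-cong-≤ zero    f≈g = f≈g 0 z≤n
  sumTo-cong-≤ (suc n) f≈g =
    +-cong (sumTo-cong-≤ n (λ l l≤n → f≈g l (ℕₚ.m≤n⇒m≤1+n l≤n))) (f≈g (suc n) ℕₚ.≤-refl)

  sumTo-+ : ∀ n (f g : ℕ → Carrier) → sumTo n (λ l → f l + g l) ≈ sumTo n f + sumTo n g
  sumTo-+ zero    f g = refl
  sumTo-+ (suc n) f g = trans (+-congʳ (sumTo-+ n f g))
    (solve 4 (λ a b c d → a :+ b :+ (c :+ d) := a :+ c :+ (b :+ d)) refl _ _ _ _)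

  *-distribˡ-sumTo : ∀ n x (f : ℕ → Carrier) → x * sumTo n f ≈ sumTo n (λ l → x * f l)
  *-distribˡ-sumTo zero    x f = refl
  *-distribˡ-sumTo (suc n) x f = trans (distribˡ _ _ _) (+-congʳ (*-distribˡ-sumTo n x f))

  sumTo-suc-head : ∀ n (f : ℕ → Carrier) → sumTo (suc n) f ≈ f 0 + sumTo n (λ l → f (suc l))
  sumTo-suc-head zero    f = refl
  sumTo-suc-head (suc n) f = trans (+-congʳ (sumTo-suc-head n f)) (+-assoc _ _ _)

  -- bt x a n = ((x + E)^n a)(0) for the shift E a = a ∘ suc.
  bt : Carrier → (ℕ → Carrier) → ℕ → Carrier
  bt x a n = sumTo n (λ l → bin n l * (pow x (n ∸ l) * a l))

  bt-0 : ∀ x a → bt x a 0 ≈ a 0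
  bt-0 x a = trans (*-congʳ (bin-0 0)) (trans (*-identityˡ _) (*-identityˡ _))

  bt-cong-≤ : ∀ x n {a b} → (∀ l → l ≤ n → a l ≈ b l) → bt x a n ≈ bt x b n
  bt-cong-≤ x n a≈b = sumTo-cong-≤ n (λ l l≤n → *-congˡ (*-congˡ (a≈b l l≤n)))

  bt-cong : ∀ x n {a b} → (∀ l → a l ≈ b l) → bt x a n ≈ bt x b n
  bt-cong x n a≈b = bt-cong-≤ x n (λ l _ → a≈b l)

  bt-cong-base : ∀ {x y} n a → x ≈ y → bt x a n ≈ bt y a n
  bt-cong-base n a x≈y = sumTo-cong n (λ l → *-congˡ (*-congʳ (pow-cong (n ∸ l) x≈y)))

  bt-+ : ∀ x n a b → bt x (λ l → a l + b l) n ≈ bt x a n + bt x b n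
  bt-+ x n a b = trans (sumTo-cong n (λ l →
      solve 4 (λ B P u v → B :* (P :* (u :+ v)) := B :* (P :* u) :+ B :* (P :* v)) refl _ _ _ _))
    (sumTo-+ n _ _)

  bt-* : ∀ x n y a → bt x (λ l → y * a l) n ≈ y * bt x a n
  bt-* x n y a = trans (sumTo-cong n (λ l →
      solve 4 (λ B P y u → B :* (P :* (y :* u)) := y :* (B :* (P :* u))) refl _ _ _ _))
    (sym (*-distribˡ-sumTo n y _))

  *-bt : ∀ x a n → x * bt x a n ≈ sumTo (suc n) (λ l → bin n l * (pow x (suc n ∸ l) * a l))
  *-bt x a n = begin
      x * bt x a n
    ≈⟨ *-distribˡ-sumTo n x _ ⟩
      sumTo n (λ l → x * (bin n l * (pow x (n ∸ l) * a l)))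
    ≈⟨ sumTo-cong-≤ n absorb ⟩
      sumTo n (λ l → bin n l * (pow x (suc n ∸ l) * a l))
    ≈⟨ +-identityʳ _ ⟨
      sumTo n (λ l → bin n l * (pow x (suc n ∸ l) * a l)) + 0#
    ≈⟨ +-congˡ (trans (*-congʳ (bin-> (ℕₚ.n<1+n n))) (zeroˡ _)) ⟨
      sumTo (suc n) (λ l → bin n l * (pow x (suc n ∸ l) * a l)) ∎
    where
    absorb : ∀ l → l ≤ n → x * (bin n l * (pow x (n ∸ l) * a l)) ≈ bin n l * (pow x (suc n ∸ l) * a l)
    absorb l l≤n = trans
      (solve 4 (λ x B P u → x :* (B :* (P :* u)) := B :* (x :* P :* u)) refl x (bin n l) (pow x (n ∸ l)) (a l))
      (reflexive (≡.cong (λ e → bin n l * (pow x e * a l)) (≡.sym (ℕₚ.+-∸-assoc 1 l≤n))))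

  bt-suc : ∀ x a n → bt x a (suc n) ≈ x * bt x a n + bt x (λ l → a (suc l)) n
  bt-suc x a n = begin
      bt x a (suc n)
    ≈⟨ sumTo-suc-head n _ ⟩
      bin n 0 * t 0 + sumTo n (λ j → bin (suc n) (suc j) * t′ j)
    ≈⟨ +-congˡ (sumTo-cong n (λ j → trans (*-congʳ (bin-suc n j)) (distribʳ _ _ _))) ⟩
      bin n 0 * t 0 + sumTo n (λ j → bin n j * t′ j + bin n (suc j) * t′ j)
    ≈⟨ +-congˡ (sumTo-+ n _ _) ⟩
      bin n 0 * t 0 + (bt x (λ l → a (suc l)) n + sumTo n (λ j → bin n (suc j) * t′ j))
    ≈⟨ solve 3 (λ a b c → a :+ (b :+ c) := a :+ c :+ b) refl (bin n 0 * t 0) _ _ ⟩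
      bin n 0 * t 0 + sumTo n (λ j → bin n (suc j) * t′ j) + bt x (λ l → a (suc l)) n
    ≈⟨ +-congʳ (trans (*-bt x a n) (sumTo-suc-head n (λ l → bin n l * t l))) ⟨
      x * bt x a n + bt x (λ l → a (suc l)) n ∎
    where
    t : ℕ → Carrier
    t l = pow x (suc n ∸ l) * a l
    t′ : ℕ → Carrier
    t′ j = t (suc j)

  bt-zero : ∀ x n → bt x (λ _ → 0#) n ≈ 0#
  bt-zero x n = trans (bt-cong x n (λ _ → sym (zeroˡ 0#))) (trans (bt-* x n 0# (λ _ → 0#)) (zeroˡ _))

  bt-concentrated : ∀ x a → (∀ l → a (suc l) ≈ 0#) → ∀ n → bt x a n ≈ pow x n * a 0
  bt-concentrated x a a≈0 zero    = trans (bt-0 x a) (sym (*-identityˡ _))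
  bt-concentrated x a a≈0 (suc n) = begin
      bt x a (suc n)
    ≈⟨ bt-suc x a n ⟩
      x * bt x a n + bt x (λ l → a (suc l)) n
    ≈⟨ +-cong (*-congˡ (bt-concentrated x a a≈0 n)) (trans (bt-cong x n a≈0) (bt-zero x n)) ⟩
      x * (pow x n * a 0) + 0#
    ≈⟨ trans (+-identityʳ _) (sym (*-assoc _ _ _)) ⟩
      pow x (suc n) * a 0 ∎

  bt-∘ : ∀ x y a n → bt x (bt y a) n ≈ bt (x + y) a n
  bt-∘ x y a zero    = trans (bt-0 x (bt y a)) (trans (bt-0 y a) (sym (bt-0 (x + y) a)))
  bt-∘ x y a (suc n) = begin
      bt x (bt y a) (suc n)
    ≈⟨ bt-suc x _ n ⟩
      x * bt x (bt y a) n + bt x (λ l → bt y a (suc l)) n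
    ≈⟨ +-congˡ (bt-cong x n (λ l → bt-suc y a l)) ⟩
      x * bt x (bt y a) n + bt x (λ l → y * bt y a l + bt y a′ l) n
    ≈⟨ +-congˡ (trans (bt-+ x n _ _) (+-congʳ (bt-* x n y _))) ⟩
      x * bt x (bt y a) n + (y * bt x (bt y a) n + bt x (bt y a′) n)
    ≈⟨ +-cong (*-congˡ (bt-∘ x y a n)) (+-cong (*-congˡ (bt-∘ x y a n)) (bt-∘ x y a′ n)) ⟩
      x * U + (y * U + bt (x + y) a′ n)
    ≈⟨ solve 4 (λ x y U V → x :* U :+ (y :* U :+ V) := (x :+ y) :* U :+ V) refl x y U _ ⟩
      (x + y) * U + bt (x + y) a′ n
    ≈⟨ bt-suc (x + y) a n ⟨
      bt (x + y) a (suc n) ∎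
    where
    a′ : ℕ → Carrier
    a′ l = a (suc l)
    U : Carrier
    U = bt (x + y) a n

  bt-pow : ∀ x y n → bt x (pow y) n ≈ pow (x + y) n
  bt-pow x y n = begin
      bt x (pow y) n
    ≈⟨ bt-cong x n (λ l → trans (sym (*-identityʳ _)) (sym (bt-concentrated y δ (λ _ → refl) l))) ⟩
      bt x (bt y δ) n
    ≈⟨ bt-∘ x y δ n ⟩
      bt (x + y) δ n
    ≈⟨ trans (bt-concentrated (x + y) δ (λ _ → refl) n) (*-identityʳ _) ⟩
      pow (x + y) n ∎
    where
    δ : ℕ → Carrier
    δ zero    = 1#
    δ (suc _) = 0#

  bt-pow-twist : ∀ x (a : ℕ → Carrier) n → bt x (λ l → pow x l * a l) n ≈ pow x n * sumTo n (λ l → bin n l * a l)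
  bt-pow-twist x a n = trans (sumTo-cong-≤ n twist) (sym (*-distribˡ-sumTo n (pow x n) _))
    where
    twist : ∀ l → l ≤ n → bin n l * (pow x (n ∸ l) * (pow x l * a l)) ≈ pow x n * (bin n l * a l)
    twist l l≤n = trans
      (solve 4 (λ B P Q u → B :* (P :* (Q :* u)) := P :* Q :* (B :* u)) refl _ _ _ _)
      (*-congʳ (pow-∸ x l≤n))

  y≈z+[-1]x⇒z≈y+x : ∀ {x y z} → y ≈ z + - 1# * x → z ≈ y + x
  y≈z+[-1]x⇒z≈y+x {x} {y} {z} y≈z-x =
    sym (trans (+-congʳ (trans y≈z-x (+-congˡ (-1*x≈-x x)))) (//-rightDividesˡ x z))

  -- diff a r = ((1 - E)^r a)(0).
  diff : (ℕ → Carrier) → ℕ → Carrier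
  diff a r = sumTo r (λ l → bin r l * (sgn l * a l))

  diff≈bt : ∀ a r → diff a r ≈ bt 1# (λ l → sgn l * a l) r
  diff≈bt a r = sumTo-cong r (λ l → *-congˡ (sym (trans (*-congʳ (pow-1# (r ∸ l))) (*-identityˡ _))))

  diff-cong : ∀ r {a b} → (∀ l → a l ≈ b l) → diff a r ≈ diff b r
  diff-cong r a≈b = sumTo-cong r (λ l → *-congˡ (*-congˡ (a≈b l)))

  diff-split : ∀ a r → diff a r ≈ diff a (suc r) + diff (λ l → a (suc l)) r
  diff-split a r = y≈z+[-1]x⇒z≈y+x (begin
      diff a (suc r)
    ≈⟨ diff≈bt a (suc r) ⟩
      bt 1# (λ l → sgn l * a l) (suc r)
    ≈⟨ bt-suc 1# _ r ⟩
      1# * bt 1# (λ l → sgn l * a l) r + bt 1# (λ l → sgn (suc l) * a (suc l)) r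
    ≈⟨ +-cong (*-identityˡ _) (bt-cong 1# r (λ l → *-assoc _ _ _)) ⟩
      bt 1# (λ l → sgn l * a l) r + bt 1# (λ l → - 1# * (sgn l * a (suc l))) r
    ≈⟨ +-cong (diff≈bt a r) (trans (*-congˡ (diff≈bt _ r)) (sym (bt-* 1# r (- 1#) _))) ⟨
      diff a r + - 1# * diff (λ l → a (suc l)) r ∎)

  backward-split : ∀ (g : ℕ → Carrier) M m →
    bt (- 1#) (λ l → g (M ∸ l)) m ≈ bt (- 1#) (λ l → g (suc M ∸ l)) (suc m) + bt (- 1#) (λ l → g (suc M ∸ l)) m
  backward-split g M m =
    y≈z+[-1]x⇒z≈y+x (trans (bt-suc (- 1#) (λ l → g (suc M ∸ l)) m) (+-comm _ _))

  diff-shift : ∀ a m r → diff (λ l → a (l ℕ.+ m)) r ≈ bt (- 1#) (λ l → diff a (m ℕ.+ r ∸ l)) m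
  diff-shift a zero    r = trans (diff-cong r (λ l → reflexive (≡.cong a (ℕₚ.+-identityʳ l))))
                               (sym (bt-0 (- 1#) (λ l → diff a (r ∸ l))))
  diff-shift a (suc m) r = +-cancelˡ (B (m ℕ.+ suc r) m) _ _ (begin
      B (m ℕ.+ suc r) m + diff (λ l → a (l ℕ.+ suc m)) r
    ≈⟨ +-cong (diff-shift a m (suc r)) (diff-cong r (λ l → reflexive (≡.cong a (≡.sym (ℕₚ.+-suc l m))))) ⟨
      diff (λ l → a (l ℕ.+ m)) (suc r) + diff (λ l → a (suc l ℕ.+ m)) r
    ≈⟨ diff-split (λ l → a (l ℕ.+ m)) r ⟨
      diff (λ l → a (l ℕ.+ m)) r
    ≈⟨ diff-shift a m r ⟩
      B (m ℕ.+ r) m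
    ≈⟨ backward-split (diff a) (m ℕ.+ r) m ⟩
      B (suc m ℕ.+ r) (suc m) + B (suc m ℕ.+ r) m
    ≈⟨ +-comm _ _ ⟩
      B (suc m ℕ.+ r) m + B (suc m ℕ.+ r) (suc m)
    ≈⟨ +-congʳ (reflexive (≡.cong (λ M → B M m) (≡.sym (ℕₚ.+-suc m r)))) ⟩
      B (m ℕ.+ suc r) m + B (suc m ℕ.+ r) (suc m) ∎)
    where
    B : ℕ → ℕ → Carrier
    B M k = bt (- 1#) (λ l → diff a (M ∸ l)) k

  bt-const : ∀ x y n → bt x (λ _ → y) n ≈ y * pow (x + 1#) n
  bt-const x y n = begin
      bt x (λ _ → y) n
    ≈⟨ bt-cong x n (λ l → sym (trans (*-congˡ (pow-1# l)) (*-identityʳ y))) ⟩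
      bt x (λ l → y * pow 1# l) n
    ≈⟨ bt-* x n y (pow 1#) ⟩
      y * bt x (pow 1#) n
    ≈⟨ *-congˡ (bt-pow x 1# n) ⟩
      y * pow (x + 1#) n ∎

  bt-[-1]-const : ∀ y m → bt (- 1#) (λ _ → y) (suc m) ≈ 0#
  bt-[-1]-const y m = begin
      bt (- 1#) (λ _ → y) (suc m)
    ≈⟨ bt-const (- 1#) y (suc m) ⟩
      y * ((- 1# + 1#) * pow (- 1# + 1#) m)
    ≈⟨ *-congˡ (trans (*-congʳ (-‿inverseˡ 1#)) (zeroˡ _)) ⟩
      y * 0#
    ≈⟨ zeroʳ y ⟩
      0# ∎

  bt-inverse-twist : ∀ {x y} → x * y ≈ 1# → ∀ (a : ℕ → Carrier) n →
    pow x n * sumTo n (λ l → bin n l * (pow y l * a l)) ≈ bt x a n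
  bt-inverse-twist {x} {y} xy≈1 a n = trans (sym (bt-pow-twist x (λ l → pow y l * a l) n))
    (bt-cong x n (λ l → trans (sym (*-assoc _ _ _)) (trans (*-congʳ (pow-inverse xy≈1 l)) (*-identityˡ _))))

module EulerNumbers {c ℓ} (R : CommutativeRing c ℓ) where
  open RingDefs R
  open BinomialSums R
  open import Relation.Binary.Reasoning.Setoid setoid
  open import Algebra.Properties.Ring ring using (+-cancelˡ; +-identityˡ-unique; //-rightDividesˡ; //-rightDividesʳ)
  open import Algebra.Solver.Ring.NaturalCoefficients.Default commutativeSemiring
    using (solve; _:+_; _:*_; _:=_; con)

  OnePlusPowersInvertible : Carrier → Set (c ⊔ ℓ)
  OnePlusPowersInvertible Q = ∀ m → 1 ≤ m → Σ Carrier (λ u → (1# + pow Q m) * u ≈ 1#)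

  invertible-cancelˡ : ∀ {a u} → a * u ≈ 1# → ∀ {x y} → a * x ≈ a * y → x ≈ y
  invertible-cancelˡ {a} {u} au≈1 {x} {y} ax≈ay = trans (recover x) (trans (*-congˡ ax≈ay) (sym (recover y)))
    where
    recover : ∀ z → z ≈ u * (a * z)
    recover z = begin
        z
      ≈⟨ *-identityˡ z ⟨
        1# * z
      ≈⟨ *-congʳ au≈1 ⟨
        a * u * z
      ≈⟨ solve 3 (λ a u z → a :* u :* z := u :* (a :* z)) refl a u z ⟩
        u * (a * z) ∎

  invertible-inverse : ∀ {q p} → q * p ≈ 1# → OnePlusPowersInvertible q → OnePlusPowersInvertible p
  invertible-inverse {q} {p} qp≈1 inv m 1≤m = let (u , [1+qᵐ]u≈1) = inv m 1≤m in pow q m * u , (begin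
      (1# + pow p m) * (pow q m * u)
    ≈⟨ solve 3 (λ P Q u → (con 1 :+ P) :* (Q :* u) := (Q :+ Q :* P) :* u) refl (pow p m) (pow q m) u ⟩
      (pow q m + pow q m * pow p m) * u
    ≈⟨ *-congʳ (trans (+-congˡ (pow-inverse qp≈1 m)) (+-comm _ _)) ⟩
      (1# + pow q m) * u
    ≈⟨ [1+qᵐ]u≈1 ⟩
      1# ∎)

  euler-top : ∀ Q (f : ℕ → Carrier) n →
    Q * sumTo (suc n) (λ l → bin (suc n) l * (pow Q l * f l)) + f (suc n)
      ≈ Q * sumTo n (λ l → bin (suc n) l * (pow Q l * f l)) + (1# + pow Q (suc (suc n))) * f (suc n)
  euler-top Q f n = begin
      Q * (S + bin (suc n) (suc n) * (pow Q (suc n) * f (suc n))) + f (suc n)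
    ≈⟨ +-congʳ (*-congˡ (+-congˡ (trans (*-congʳ (bin-diag (suc n))) (*-identityˡ _)))) ⟩
      Q * (S + pow Q (suc n) * f (suc n)) + f (suc n)
    ≈⟨ solve 4 (λ Q S P z → Q :* (S :+ P :* z) :+ z := Q :* S :+ (con 1 :+ Q :* P) :* z)
               refl Q S (pow Q (suc n)) (f (suc n)) ⟩
      Q * S + (1# + pow Q (suc (suc n))) * f (suc n) ∎
    where
    S : Carrier
    S = sumTo n (λ l → bin (suc n) l * (pow Q l * f l))

  euler-unique : ∀ {Q ξ η} → OnePlusPowersInvertible Q → IsQEuler Q ξ → IsQEuler Q η → ∀ n → ξ n ≈ η n
  euler-unique {Q} {ξ} {η} inv Eξ Eη n = agree n n ℕₚ.≤-refl
    where
    module Eξ = IsQEuler Eξ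
    module Eη = IsQEuler Eη

    top-agrees : ∀ n → (∀ l → l ≤ n → ξ l ≈ η l) → ξ (suc n) ≈ η (suc n)
    top-agrees n below = invertible-cancelˡ (proj₂ (inv (suc (suc n)) (s≤s z≤n)))
      (+-cancelˡ (Q * S η) _ _ (begin
        Q * S η + (1# + pow Q (suc (suc n))) * ξ (suc n)
      ≈⟨ +-congʳ (*-congˡ (sumTo-cong-≤ n (λ l l≤n → *-congˡ (*-congˡ (below l l≤n))))) ⟨
        Q * S ξ + (1# + pow Q (suc (suc n))) * ξ (suc n)
      ≈⟨ euler-top Q ξ n ⟨
        Q * sumTo (suc n) (λ l → bin (suc n) l * (pow Q l * ξ l)) + ξ (suc n)
      ≈⟨ trans (Eξ.rec (suc n) (s≤s z≤n)) (sym (Eη.rec (suc n) (s≤s z≤n))) ⟩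
        Q * sumTo (suc n) (λ l → bin (suc n) l * (pow Q l * η l)) + η (suc n)
      ≈⟨ euler-top Q η n ⟩
        Q * S η + (1# + pow Q (suc (suc n))) * η (suc n) ∎))
      where
      S : (ℕ → Carrier) → Carrier
      S f = sumTo n (λ l → bin (suc n) l * (pow Q l * f l))

    agree : ∀ n l → l ≤ n → ξ l ≈ η l
    agree 0       .0    z≤n = trans Eξ.init (sym Eη.init)
    agree (suc n) l   l≤1+n with ℕₚ.m≤n⇒m<n∨m≡n l≤1+n
    ... | inj₁ (s≤s l≤n) = agree n l l≤n
    ... | inj₂ ≡.refl    = top-agrees n (agree n)

  module Reflection (q p : Carrier) (qp≈1 : q * p ≈ 1#) (ξ : ℕ → Carrier) (Eξ : IsQEuler q ξ) where
    module Eξ = IsQEuler Eξ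

    diff-0 : diff ξ 0 ≈ 1#
    diff-0 = trans (*-congʳ (bin-0 0)) (trans (*-identityˡ _) (trans (*-identityˡ _) Eξ.init))

    euler-binomial : ∀ n → q * (pow q n * diff ξ n) + bt q (diff ξ) n ≈ pow (q + 1#) n * (q + 1#)
    euler-binomial n = sym (begin
        pow (q + 1#) n * (q + 1#)
      ≈⟨ *-congˡ (trans (*-identityˡ _) residue-0) ⟨
        pow (q + 1#) n * (sgn 0 * residue 0)
      ≈⟨ bt-concentrated (q + 1#) (λ m → sgn m * residue m) (λ m → trans (*-congˡ (residue-suc m)) (zeroʳ _)) n ⟨
        bt (q + 1#) (λ m → sgn m * residue m) n
      ≈⟨ bt-cong (q + 1#) n (λ m →
           solve 4 (λ s q t x → s :* (q :* t :+ x) := q :* (s :* t) :+ s :* x) refl (sgn m) q (S m) (ξ m)) ⟩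
        bt (q + 1#) (λ m → q * (sgn m * S m) + sgn m * ξ m) n
      ≈⟨ trans (bt-+ (q + 1#) n _ _) (+-congʳ (bt-* (q + 1#) n q _)) ⟩
        q * bt (q + 1#) (λ m → sgn m * S m) n + bt (q + 1#) (λ m → sgn m * ξ m) n
      ≈⟨ +-cong (*-congˡ twisted) untwisted ⟩
        q * (pow q n * diff ξ n) + bt q (diff ξ) n ∎)
      where
      S : ℕ → Carrier
      S m = sumTo m (λ l → bin m l * (pow q l * ξ l))
      residue : ℕ → Carrier
      residue m = q * S m + ξ m
      residue-0 : residue 0 ≈ q + 1#
      residue-0 = +-cong (trans (*-congˡ diff-0) (*-identityʳ q)) Eξ.init
      residue-suc : ∀ m → residue (suc m) ≈ 0#
      residue-suc m = Eξ.rec (suc m) (s≤s z≤n)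
      twisted : bt (q + 1#) (λ m → sgn m * S m) n ≈ pow q n * diff ξ n
      twisted = begin
          bt (q + 1#) (λ m → sgn m * S m) n
        ≈⟨ bt-cong (q + 1#) n (λ m → sym (bt-pow-twist (- 1#) (λ l → pow q l * ξ l) m)) ⟩
          bt (q + 1#) (bt (- 1#) (λ l → sgn l * (pow q l * ξ l))) n
        ≈⟨ bt-∘ (q + 1#) (- 1#) _ n ⟩
          bt (q + 1# + - 1#) (λ l → sgn l * (pow q l * ξ l)) n
        ≈⟨ bt-cong-base n _ (//-rightDividesʳ 1# q) ⟩
          bt q (λ l → sgn l * (pow q l * ξ l)) n
        ≈⟨ bt-cong q n (λ l → solve 3 (λ s Q x → s :* (Q :* x) := Q :* (s :* x)) refl (sgn l) (pow q l) (ξ l)) ⟩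
          bt q (λ l → pow q l * (sgn l * ξ l)) n
        ≈⟨ bt-pow-twist q (λ l → sgn l * ξ l) n ⟩
          pow q n * diff ξ n ∎
      untwisted : bt (q + 1#) (λ m → sgn m * ξ m) n ≈ bt q (diff ξ) n
      untwisted = trans (sym (bt-∘ q 1# _ n)) (bt-cong q n (λ m → sym (diff≈bt ξ m)))

    η : ℕ → Carrier
    η zero    = 1#
    η (suc l) = pow p 2 * (diff ξ (suc l) - (1# + q))

    boundary : ℕ → Carrier
    boundary zero    = pow q 2 + q
    boundary (suc _) = 0#

    η-diff : ∀ l → pow q 2 * η l + (1# + q) ≈ diff ξ l + boundary l
    η-diff zero = begin
        pow q 2 * 1# + (1# + q)
      ≈⟨ solve 1 (λ q → q :* (q :* con 1) :* con 1 :+ (con 1 :+ q) := con 1 :+ (q :* (q :* con 1) :+ q)) refl q ⟩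
        1# + (pow q 2 + q)
      ≈⟨ +-congʳ diff-0 ⟨
        diff ξ 0 + (pow q 2 + q) ∎
    η-diff (suc l) = begin
        pow q 2 * (pow p 2 * (diff ξ (suc l) - (1# + q))) + (1# + q)
      ≈⟨ +-congʳ (trans (sym (*-assoc _ _ _)) (trans (*-congʳ (pow-inverse qp≈1 2)) (*-identityˡ _))) ⟩
        diff ξ (suc l) - (1# + q) + (1# + q)
      ≈⟨ //-rightDividesˡ (1# + q) _ ⟩
        diff ξ (suc l)
      ≈⟨ +-identityʳ _ ⟨
        diff ξ (suc l) + 0# ∎

    bt-η : ∀ n → pow q 2 * bt q η n + (1# + q) * pow (q + 1#) n ≈ bt q (diff ξ) n + pow q n * (pow q 2 + q)
    bt-η n = begin
        pow q 2 * bt q η n + (1# + q) * pow (q + 1#) n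
      ≈⟨ +-cong (bt-* q n (pow q 2) η) (bt-const q (1# + q) n) ⟨
        bt q (λ l → pow q 2 * η l) n + bt q (λ _ → 1# + q) n
      ≈⟨ bt-+ q n _ _ ⟨
        bt q (λ l → pow q 2 * η l + (1# + q)) n
      ≈⟨ bt-cong q n η-diff ⟩
        bt q (λ l → diff ξ l + boundary l) n
      ≈⟨ bt-+ q n _ _ ⟩
        bt q (diff ξ) n + bt q boundary n
      ≈⟨ +-congˡ (bt-concentrated q boundary (λ _ → refl) n) ⟩
        bt q (diff ξ) n + pow q n * (pow q 2 + q) ∎

    η-euler : IsQEuler p η
    η-euler = record { init = refl ; rec = η-rec }
      where
      η-rec : (n : ℕ) → 1 ≤ n → p * sumTo n (λ l → bin n l * (pow p l * η l)) + η n ≈ 0#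
      η-rec (suc n) _ = invertible-cancelˡ a-invertible (trans scaled-vanishes (sym (zeroʳ a)))
        where
        N : ℕ
        N = suc n
        S : Carrier
        S = sumTo N (λ l → bin N l * (pow p l * η l))
        a : Carrier
        a = pow q 2 * pow q (suc N)
        a-invertible : a * (pow p 2 * pow p (suc N)) ≈ 1#
        a-invertible = trans (solve 4 (λ A B C D → A :* B :* (C :* D) := A :* C :* (B :* D)) refl _ _ _ _)
          (trans (*-cong (pow-inverse qp≈1 2) (pow-inverse qp≈1 (suc N))) (*-identityˡ 1#))
        K : Carrier
        K = (1# + q) * pow (q + 1#) N + (1# + q) * (q * pow q N)
        scaled-vanishes : a * (p * S + η N) ≈ 0#
        scaled-vanishes = +-identityˡ-unique _ K (begin
            a * (p * S + η N) + K
          ≈⟨ +-congʳ (solve 5 (λ q p Q S e → q :* (q :* con 1) :* (q :* Q) :* (p :* S :+ e)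
                                := q :* (q :* con 1) :* (q :* p :* (Q :* S)) :+ q :* Q :* (q :* (q :* con 1) :* e))
                               refl q p (pow q N) S (η N)) ⟩
            pow q 2 * (q * p * (pow q N * S)) + q * pow q N * (pow q 2 * η N) + K
          ≈⟨ +-congʳ (+-congʳ (*-congˡ (trans (*-congʳ qp≈1) (trans (*-identityˡ _) (bt-inverse-twist qp≈1 η N))))) ⟩
            pow q 2 * bt q η N + q * pow q N * (pow q 2 * η N) + K
          ≈⟨ solve 5 (λ A B E C P → A :+ B :* E :+ (C :* P :+ C :* B) := A :+ C :* P :+ B :* (E :+ C))
                     refl (pow q 2 * bt q η N) (q * pow q N) (pow q 2 * η N) (1# + q) (pow (q + 1#) N) ⟩
            pow q 2 * bt q η N + (1# + q) * pow (q + 1#) N + q * pow q N * (pow q 2 * η N + (1# + q))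
          ≈⟨ +-cong (bt-η N) (*-congˡ (trans (η-diff N) (+-identityʳ _))) ⟩
            bt q (diff ξ) N + pow q N * (pow q 2 + q) + q * pow q N * diff ξ N
          ≈⟨ solve 5 (λ T Q W q D → T :+ Q :* W :+ q :* Q :* D := q :* (Q :* D) :+ T :+ Q :* W)
                     refl (bt q (diff ξ) N) (pow q N) (pow q 2 + q) q (diff ξ N) ⟩
            q * (pow q N * diff ξ N) + bt q (diff ξ) N + pow q N * (pow q 2 + q)
          ≈⟨ +-congʳ (euler-binomial N) ⟩
            pow (q + 1#) N * (q + 1#) + pow q N * (pow q 2 + q)
          ≈⟨ solve 3 (λ q P Q → P :* (q :+ con 1) :+ Q :* (q :* (q :* con 1) :+ q)
                                := (con 1 :+ q) :* P :+ (con 1 :+ q) :* (q :* Q))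
                     refl q (pow (q + 1#) N) (pow q N) ⟩
            K ∎)

    reflection : ∀ {ξ'} → OnePlusPowersInvertible p → IsQEuler p ξ' →
      ∀ n → 1 ≤ n → diff ξ n ≈ (1# + q) + pow q 2 * ξ' n
    reflection {ξ'} inv Eξ' (suc n) _ = begin
        diff ξ (suc n)
      ≈⟨ +-identityʳ _ ⟨
        diff ξ (suc n) + 0#
      ≈⟨ η-diff (suc n) ⟨
        pow q 2 * η (suc n) + (1# + q)
      ≈⟨ +-comm _ _ ⟩
        (1# + q) + pow q 2 * η (suc n)
      ≈⟨ +-congˡ (*-congˡ (euler-unique inv Eξ' η-euler (suc n))) ⟨
        (1# + q) + pow q 2 * ξ' (suc n) ∎

    shifted-reflection : ∀ {ξ'} → OnePlusPowersInvertible p → IsQEuler p ξ' →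
      ∀ m N → 1 ≤ m → m < N →
      diff (λ l → ξ (l ℕ.+ m)) (N ∸ m) ≈ pow q 2 * sumTo m (λ l → bin m l * (sgn (m ∸ l) * ξ' (N ∸ l)))
    shifted-reflection {ξ'} inv Eξ' (suc m) N _ m<N = begin
        diff (λ l → ξ (l ℕ.+ suc m)) (N ∸ suc m)
      ≈⟨ diff-shift ξ (suc m) (N ∸ suc m) ⟩
        bt (- 1#) (λ l → diff ξ (suc m ℕ.+ (N ∸ suc m) ∸ l)) (suc m)
      ≡⟨ ≡.cong (λ M → bt (- 1#) (λ l → diff ξ (M ∸ l)) (suc m)) (ℕₚ.m+[n∸m]≡n (ℕₚ.<⇒≤ m<N)) ⟩
        bt (- 1#) (λ l → diff ξ (N ∸ l)) (suc m)
      ≈⟨ bt-cong-≤ (- 1#) (suc m) (λ l l≤m →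
           reflection inv Eξ' (N ∸ l) (ℕₚ.m<n⇒0<n∸m (ℕₚ.≤-<-trans l≤m m<N))) ⟩
        bt (- 1#) (λ l → (1# + q) + pow q 2 * ξ' (N ∸ l)) (suc m)
      ≈⟨ bt-+ (- 1#) (suc m) _ _ ⟩
        bt (- 1#) (λ _ → 1# + q) (suc m) + bt (- 1#) (λ l → pow q 2 * ξ' (N ∸ l)) (suc m)
      ≈⟨ +-cong (bt-[-1]-const (1# + q) m) (bt-* (- 1#) (suc m) (pow q 2) _) ⟩
        0# + pow q 2 * bt (- 1#) (λ l → ξ' (N ∸ l)) (suc m)
      ≈⟨ +-identityˡ _ ⟩
        pow q 2 * bt (- 1#) (λ l → ξ' (N ∸ l)) (suc m) ∎

theorem9 : ∀ {c ℓ} (R : CommutativeRing c ℓ) →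
    let open RingDefs R in
    (q q⁻¹ : Carrier) → q * q⁻¹ ≈ 1# →
    ((m : ℕ) → 1 ≤ m → Σ Carrier (λ u → (1# + pow q m) * u ≈ 1#)) →
    (ξ ξ' : ℕ → Carrier) → IsQEuler q ξ → IsQEuler q⁻¹ ξ' →
    (s : ℕ) → 1 ≤ s → (ns : Vec ℕ s) → (k : ℕ) →
    s ℕ.* k < sum ns →
    ((0 < k →
       sumTo (sum ns ℕ.∸ s ℕ.* k)
         (λ l → bin (sum ns ℕ.∸ s ℕ.* k) l * (sgn l * ξ (l ℕ.+ s ℕ.* k)))
       ≈ pow q 2 * sumTo (s ℕ.* k)
         (λ l → bin (s ℕ.* k) l * (sgn (s ℕ.* k ℕ.∸ l) * ξ' (sum ns ℕ.∸ l))))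
     ×
     (k ≡ 0 →
       sumTo (sum ns) (λ l → bin (sum ns) l * (sgn l * ξ l))
       ≈ (1# + q) + pow q 2 * ξ' (sum ns)))
theorem9 R q q⁻¹ qq⁻¹≈1 inv ξ ξ' Eξ Eξ' s 1≤s ns k sk<N =
    (λ 0<k → shifted-reflection inv⁻¹ Eξ' (s ℕ.* k) (sum ns) (ℕₚ.*-mono-≤ 1≤s 0<k) sk<N)
  , (λ { ≡.refl → reflection inv⁻¹ Eξ' (sum ns) (ℕₚ.≤-trans (s≤s z≤n) sk<N) })
  where
  open EulerNumbers R
  open Reflection q q⁻¹ qq⁻¹≈1 ξ Eξ

  inv⁻¹ : OnePlusPowersInvertible q⁻¹
  inv⁻¹ = invertible-inverse qq⁻¹≈1 inv
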